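{- Let $k\in\mathbb{N}_0$ and let $(A,B)$ be a suitable pair of $k$-tuples, $A=(a_1,\dots,a_k)$, $B=(b_1,\dots,b_k)$, with compound sequence $G=G(A,B)=(g_0,\dots,g_k)$. For $0\le j\le k$ let $\rho_j(G)=(g_j,g_{j-1},\dots,g_0,g_{j+1},\dots,g_k)$. Then $\rho_j(G)$ is a smooth sequence (with leading term $g_j$), and its $c$ values are $(b_j,b_{j-1},\dots,b_1,a_{j+1},\dots,a_k)$.
   Context: $A,B\in\mathbb{N}^k$ (positive integers) form a suitable pair if $\gcd(a_i,b_j)=1$ for all $i\ge j$; then $g_i=b_1\cdots b_i\,a_{i+1}\cdots a_k$ for $0\le i\le k$ and $G(A,B)=(g_0,\dots,g_k)$ is the associated compound sequence. For a sequence $H=(h_0,\dots,h_k)$ of positive integers, let $d_i=\gcd(h_0,\dots,h_i)$ and $c_i=d_{i-1}/d_i$ for $1\le i\le k$ (the $c$ values of $H$); $H$ is smooth if $c_ih_i\in\langle h_0,\dots,h_{i-1}\rangle$ for $1\le i\le k$, where $\langle\cdot\rangle$ denotes the set of finite non-negative integer linear combinations. -}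

module Defs where

open import Data.Nat using (ℕ; zero; suc; _+_; _*_; _∸_; _<_; _≤_; _<ᵇ_; _≤ᵇ_)
open import Data.Nat.DivMod using (_/_)
open import Data.Nat.GCD using (gcd)
open import Data.Nat.Coprimality using (Coprime)
open import Data.Fin using (Fin; toℕ)
open import Data.List using (map; allFin)
open import Data.Nat.ListAction using (product)
open import Data.Bool using (if_then_else_)
open import Data.Product using (Σ; _×_)
open import Relation.Binary.PropositionalEquality using (_≡_)

-- k-tuples A = (a_1..a_k) are functions Fin k → ℕ, with a_{m+1} = a m (0-based).

Positive : ∀ {k} → (Fin k → ℕ) → Set
Positive a = ∀ m → 0 < a m

Suitable : ∀ {k} → (Fin k → ℕ) → (Fin k → ℕ) → Set
Suitable a b = ∀ i j → toℕ j ≤ toℕ i → Coprime (a i) (b j)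

-- g_i = b_1 ⋯ b_i a_{i+1} ⋯ a_k : factor m (0-based) is b m if m < i, else a m
compound : ∀ {k} → (Fin k → ℕ) → (Fin k → ℕ) → ℕ → ℕ
compound {k} a b i = product (map (λ m → if toℕ m <ᵇ i then b m else a m) (allFin k))

-- a sequence H = (h_0,…,h_k) is represented by h : ℕ → ℕ (only indices 0..k matter)

dseq : (ℕ → ℕ) → ℕ → ℕ
dseq h zero = h zero
dseq h (suc i) = gcd (dseq h i) (h (suc i))

-- total quotient (divisor 0 never occurs for positive sequences)
quot : ℕ → ℕ → ℕ
quot m zero = zero
quot m (suc n) = m / suc n

-- c_i = d_{i-1} / d_i   (meaningful for i ≥ 1)
cval : (ℕ → ℕ) → ℕ → ℕ
cval h i = quot (dseq h (i ∸ 1)) (dseq h i)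

sumTo : ℕ → (ℕ → ℕ) → ℕ
sumTo zero f = zero
sumTo (suc n) f = sumTo n f + f n

InSemigroup : (ℕ → ℕ) → ℕ → ℕ → Set
InSemigroup h i x = Σ (ℕ → ℕ) (λ λs → x ≡ sumTo i (λ m → λs m * h m))

Smooth : ℕ → (ℕ → ℕ) → Set
Smooth k h = ∀ i → 1 ≤ i → i ≤ k → InSemigroup h i (cval h i * h i)

rho : ℕ → (ℕ → ℕ) → ℕ → ℕ
rho j g m = if m ≤ᵇ j then g (j ∸ m) else g m

module Submission where

-- Write the compound sequence as g_l = P_l · T_l with the prefix product
-- P_l = b_0 ⋯ b_{l-1} and the suffix product T_l = a_l ⋯ a_{k-1} (0-based).
-- For h = ρ_j(g) the running gcds are
--   d_i = P_{j-i} · T_j   for i ≤ j,     and     d_i = T_i   for j ≤ i ≤ k,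
-- because each new term only adds a factor coprime to the new candidate
-- (suitability: gcd(a_m, b_l) = 1 for m ≥ l).  Dividing consecutive gcds
-- gives the c values b_{j-1}, …, b_0, a_j, …, a_{k-1}.  Smoothness then
-- follows from the one identity  a_l · g_{l+1} = b_l · g_l :  c_i h_i is a
-- single multiple of an earlier term of h.

open import Defs
open import Data.Nat using (ℕ; zero; suc; _+_; _*_; _∸_; _<_; _≤_; z≤n; s≤s; s≤s⁻¹; _<ᵇ_; _≤ᵇ_; _≟_; _≤?_)
open import Data.Nat.Properties
open import Data.Nat.GCD using (gcd; c*gcd[m,n]≡gcd[cm,cn])
open import Data.Nat.Coprimality using (Coprime; coprime⇒gcd≡1; coprime-divisor; 1-coprimeTo)
import Data.Nat.Coprimality as Coprimality
open import Data.Nat.Divisibility using (∣-trans)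
open import Data.Nat.DivMod using (_/_; m*n/n≡m)
open import Data.Nat.ListAction using (product)
open import Data.Nat.Solver using (module +-*-Solver)
open import Data.Fin using (Fin; toℕ; fromℕ<) renaming (zero to fzero; suc to fsuc)
open import Data.Fin.Properties using (toℕ-fromℕ<; toℕ<n)
open import Data.List using (tabulate)
open import Data.List.Properties using (map-tabulate)
open import Data.Bool using (true; false; if_then_else_; T)
open import Data.Unit using (tt)
open import Data.Empty using (⊥-elim)
open import Function using (_∘′_)
open import Data.Sum using (inj₁; inj₂)
open import Data.Product using (Σ; _×_; _,_)
open import Relation.Nullary using (yes; no)
open import Relation.Binary.PropositionalEquality
  using (_≡_; _≢_; refl; sym; trans; cong; cong₂; subst; subst₂; module ≡-Reasoning)

open +-*-Solver using (solve; _:*_; _:=_)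

*-pos : ∀ {x y} → 0 < x → 0 < y → 0 < x * y
*-pos {suc x} {suc y} _ _ = s≤s z≤n

quot-cancel : ∀ c x → 0 < c → quot (c * x) c ≡ x
quot-cancel (suc c) x _ = trans (cong (_/ suc c) (*-comm (suc c) x)) (m*n/n≡m x (suc c))

coprime-* : ∀ {x y z} → Coprime x y → Coprime x z → Coprime x (y * z)
coprime-* {x} {y} {z} x⊥y x⊥z {d} (d∣x , d∣yz) = x⊥z (d∣x , coprime-divisor d⊥y d∣yz)
  where
  d⊥y : Coprime d y
  d⊥y (e∣d , e∣y) = x⊥y (∣-trans e∣d d∣x , e∣y)

gcd-common-factor : ∀ c x y → Coprime x y → gcd (c * x) (c * y) ≡ c
gcd-common-factor c x y x⊥y = begin
  gcd (c * x) (c * y) ≡⟨ c*gcd[m,n]≡gcd[cm,cn] c x y ⟨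
  c * gcd x y         ≡⟨ cong (c *_) (coprime⇒gcd≡1 x⊥y) ⟩
  c * 1               ≡⟨ *-identityʳ c ⟩
  c                   ∎
  where open ≡-Reasoning

∸-unfold : ∀ {j l} → l < j → j ∸ l ≡ suc (j ∸ suc l)
∸-unfold {suc j} {zero} _ = refl
∸-unfold {suc j} {suc l} (s≤s l<j) = ∸-unfold l<j

<ᵇ-true : ∀ {m n} → m < n → (m <ᵇ n) ≡ true
<ᵇ-true {m} {n} m<n with m <ᵇ n | <⇒<ᵇ m<n
... | true | _ = refl

<ᵇ-false : ∀ {m n} → n ≤ m → (m <ᵇ n) ≡ false
<ᵇ-false {m} {n} n≤m with m <ᵇ n in eq
... | false = refl
... | true = ⊥-elim (<⇒≱ (<ᵇ⇒< m n (subst T (sym eq) tt)) n≤m)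

≤ᵇ-true : ∀ {m n} → m ≤ n → (m ≤ᵇ n) ≡ true
≤ᵇ-true {m} {n} m≤n with m ≤ᵇ n | ≤⇒≤ᵇ m≤n
... | true | _ = refl

≤ᵇ-false : ∀ {m n} → n < m → (m ≤ᵇ n) ≡ false
≤ᵇ-false {m} {n} n<m with m ≤ᵇ n in eq
... | false = refl
... | true = ⊥-elim (<⇒≱ n<m (≤ᵇ⇒≤ m n (subst T (sym eq) tt)))

rho-below : ∀ {j i} (g : ℕ → ℕ) → i ≤ j → rho j g i ≡ g (j ∸ i)
rho-below {j} {i} g i≤j rewrite ≤ᵇ-true i≤j = refl

rho-above : ∀ {j i} (g : ℕ → ℕ) → j < i → rho j g i ≡ g i
rho-above {j} {i} g j<i rewrite ≤ᵇ-false j<i = refl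

module SingleGenerator (h : ℕ → ℕ) (c p : ℕ) where

  coeff : ℕ → ℕ
  coeff m with m ≟ p
  ... | yes _ = c
  ... | no _ = 0

  coeff-on : coeff p ≡ c
  coeff-on with p ≟ p
  ... | yes _ = refl
  ... | no p≢p = ⊥-elim (p≢p refl)

  coeff-off : ∀ {m} → m ≢ p → coeff m ≡ 0
  coeff-off {m} m≢p with m ≟ p
  ... | yes m≡p = ⊥-elim (m≢p m≡p)
  ... | no _ = refl

  term : ℕ → ℕ
  term m = coeff m * h m

  sum-before : ∀ i → i ≤ p → sumTo i term ≡ 0
  sum-before zero _ = refl
  sum-before (suc i) i<p =
    cong₂ _+_ (sum-before i (<⇒≤ i<p)) (cong (_* h i) (coeff-off (<⇒≢ i<p)))

  sum-after : ∀ i → p < i → sumTo i term ≡ c * h p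
  sum-after (suc i) (s≤s p≤i) with m≤n⇒m<n∨m≡n p≤i
  ... | inj₁ p<i = trans (cong₂ _+_ (sum-after i p<i) (cong (_* h i) (coeff-off (<⇒≢ p<i ∘′ sym))))
                         (+-identityʳ _)
  ... | inj₂ refl = cong₂ _+_ (sum-before p ≤-refl) (cong (_* h p) coeff-on)

single-generator : ∀ (h : ℕ → ℕ) c {p i} → p < i → InSemigroup h i (c * h p)
single-generator h c {p} {i} p<i = coeff , sym (sum-after i p<i)
  where open SingleGenerator h c p

prodFrom : ℕ → ℕ → (ℕ → ℕ) → ℕ
prodFrom s zero f = 1
prodFrom s (suc n) f = f s * prodFrom (suc s) n f

prodFrom-split : ∀ s m n f → prodFrom s (m + n) f ≡ prodFrom s m f * prodFrom (s + m) n f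
prodFrom-split s zero n f = trans (cong (λ t → prodFrom t n f) (sym (+-identityʳ s))) (sym (+-identityʳ _))
prodFrom-split s (suc m) n f = begin
  f s * prodFrom (suc s) (m + n) f                             ≡⟨ cong (f s *_) (prodFrom-split (suc s) m n f) ⟩
  f s * (prodFrom (suc s) m f * prodFrom (suc s + m) n f)      ≡⟨ *-assoc (f s) _ _ ⟨
  f s * prodFrom (suc s) m f * prodFrom (suc s + m) n f        ≡⟨ cong (λ t → f s * prodFrom (suc s) m f * prodFrom t n f) (+-suc s m) ⟨
  f s * prodFrom (suc s) m f * prodFrom (s + suc m) n f        ∎
  where open ≡-Reasoning

prodFrom-snoc : ∀ s n f → prodFrom s (suc n) f ≡ prodFrom s n f * f (s + n)
prodFrom-snoc s n f = begin
  prodFrom s (suc n) f                     ≡⟨ cong (λ m → prodFrom s m f) (+-comm 1 n) ⟩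
  prodFrom s (n + 1) f                     ≡⟨ prodFrom-split s n 1 f ⟩
  prodFrom s n f * (f (s + n) * 1)         ≡⟨ cong (prodFrom s n f *_) (*-identityʳ _) ⟩
  prodFrom s n f * f (s + n)               ∎
  where open ≡-Reasoning

prodFrom-cong : ∀ s n f f′ → (∀ m → s ≤ m → m < s + n → f m ≡ f′ m) → prodFrom s n f ≡ prodFrom s n f′
prodFrom-cong s zero f f′ agree = refl
prodFrom-cong s (suc n) f f′ agree =
  cong₂ _*_ (agree s ≤-refl (m<m+n s (s≤s z≤n)))
            (prodFrom-cong (suc s) n f f′ λ m s<m m<end → agree m (<⇒≤ s<m) (subst (m <_) (sym (+-suc s n)) m<end))

prodFrom-pos : ∀ s n f → (∀ m → 0 < f m) → 0 < prodFrom s n f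
prodFrom-pos s zero f pos = s≤s z≤n
prodFrom-pos s (suc n) f pos = *-pos (pos s) (prodFrom-pos (suc s) n f pos)

prodFrom-coprime : ∀ x s n f → (∀ m → s ≤ m → m < s + n → Coprime x (f m)) → Coprime x (prodFrom s n f)
prodFrom-coprime x s zero f cop = Coprimality.sym (1-coprimeTo x)
prodFrom-coprime x s (suc n) f cop =
  coprime-* (cop s ≤-refl (m<m+n s (s≤s z≤n)))
            (prodFrom-coprime x (suc s) n f λ m s<m m<end → cop m (<⇒≤ s<m) (subst (m <_) (sym (+-suc s n)) m<end))

-- From Fin-indexed tuples to ℕ-indexed sequences: extend f agrees with f
-- on 0 … k-1 and is 1 beyond, so it stays positive.

extend : ∀ {k} → (Fin k → ℕ) → ℕ → ℕ
extend {zero} f n = 1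
extend {suc k} f zero = f fzero
extend {suc k} f (suc n) = extend (λ m → f (fsuc m)) n

extend-toℕ : ∀ {k} (f : Fin k → ℕ) (m : Fin k) → extend f (toℕ m) ≡ f m
extend-toℕ f fzero = refl
extend-toℕ f (fsuc m) = extend-toℕ (λ x → f (fsuc x)) m

extend-fromℕ< : ∀ {k n} (f : Fin k → ℕ) (n<k : n < k) → extend f n ≡ f (fromℕ< n<k)
extend-fromℕ< f n<k = trans (cong (extend f) (sym (toℕ-fromℕ< n<k))) (extend-toℕ f (fromℕ< n<k))

extend-pos : ∀ {k} (f : Fin k → ℕ) → Positive f → ∀ n → 0 < extend f n
extend-pos {zero} f pos n = s≤s z≤n
extend-pos {suc k} f pos zero = pos fzero
extend-pos {suc k} f pos (suc n) = extend-pos (λ x → f (fsuc x)) (λ m → pos (fsuc m)) n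

extend-suitable : ∀ {k} (a b : Fin k → ℕ) → Suitable a b →
  ∀ i l → l ≤ i → i < k → Coprime (extend a i) (extend b l)
extend-suitable a b suitable i l l≤i i<k =
  subst₂ Coprime (sym (extend-fromℕ< a i<k)) (sym (extend-fromℕ< b l<k))
    (suitable (fromℕ< i<k) (fromℕ< l<k) (subst₂ _≤_ (sym (toℕ-fromℕ< l<k)) (sym (toℕ-fromℕ< i<k)) l≤i))
  where
  l<k = ≤-<-trans l≤i i<k

product-allFin : ∀ {k} (F : Fin k → ℕ) (f : ℕ → ℕ) s →
  (∀ m → F m ≡ f (toℕ m + s)) → product (tabulate F) ≡ prodFrom s k f
product-allFin {zero} F f s agree = refl
product-allFin {suc k} F f s agree =
  cong₂ _*_ (agree fzero)
    (product-allFin (λ m → F (fsuc m)) f (suc s) λ m → trans (agree (fsuc m)) (cong f (sym (+-suc (toℕ m) s))))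

module CompoundSequence (k : ℕ) (a b : ℕ → ℕ) where

  pre : ℕ → ℕ
  pre l = prodFrom 0 l b

  suf : ℕ → ℕ
  suf l = prodFrom l (k ∸ l) a

  select : ℕ → ℕ → ℕ
  select l n = if n <ᵇ l then b n else a n

  pre-step : ∀ l → pre (suc l) ≡ pre l * b l
  pre-step l = prodFrom-snoc 0 l b

  suf-step : ∀ {l} → l < k → suf l ≡ a l * suf (suc l)
  suf-step {l} l<k = cong (λ n → prodFrom l n a) (∸-unfold l<k)

  suf-split : ∀ n l → n + l ≤ k → suf l ≡ prodFrom l n a * suf (n + l)
  suf-split zero l _ = sym (*-identityˡ (suf l))
  suf-split (suc n) l n+l<k = begin
    suf l                                                ≡⟨ suf-step (≤-<-trans (m≤n+m l n) n+l<k) ⟩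
    a l * suf (suc l)                                    ≡⟨ cong (a l *_) (suf-split n (suc l) (subst (_≤ k) (sym (+-suc n l)) n+l<k)) ⟩
    a l * (prodFrom (suc l) n a * suf (n + suc l))       ≡⟨ *-assoc (a l) _ _ ⟨
    prodFrom l (suc n) a * suf (n + suc l)               ≡⟨ cong (λ m → prodFrom l (suc n) a * suf m) (+-suc n l) ⟩
    prodFrom l (suc n) a * suf (suc n + l)               ∎
    where open ≡-Reasoning

  select-factorisation : ∀ l → l ≤ k → prodFrom 0 k (select l) ≡ pre l * suf l
  select-factorisation l l≤k = begin
    prodFrom 0 k (select l)                                  ≡⟨ cong (λ n → prodFrom 0 n (select l)) (m+[n∸m]≡n l≤k) ⟨
    prodFrom 0 (l + (k ∸ l)) (select l)                      ≡⟨ prodFrom-split 0 l (k ∸ l) (select l) ⟩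
    prodFrom 0 l (select l) * prodFrom l (k ∸ l) (select l)  ≡⟨ cong₂ _*_ (prodFrom-cong 0 l _ b λ m _ m<l → selects-b m<l)
                                                                          (prodFrom-cong l (k ∸ l) _ a λ m l≤m _ → selects-a l≤m) ⟩
    pre l * suf l                                            ∎
    where
    open ≡-Reasoning
    selects-b : ∀ {m} → m < l → select l m ≡ b m
    selects-b m<l rewrite <ᵇ-true m<l = refl
    selects-a : ∀ {m} → l ≤ m → select l m ≡ a m
    selects-a l≤m rewrite <ᵇ-false l≤m = refl

  -- The identity behind smoothness: a_l · g_{l+1} = b_l · g_l.
  factor-exchange : ∀ {l} → l < k → a l * (pre (suc l) * suf (suc l)) ≡ b l * (pre l * suf l)
  factor-exchange {l} l<k = begin
    a l * (pre (suc l) * suf (suc l))         ≡⟨ cong (λ x → a l * (x * suf (suc l))) (pre-step l) ⟩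
    a l * (pre l * b l * suf (suc l))         ≡⟨ exchange (pre l) (a l) (b l) (suf (suc l)) ⟩
    b l * (pre l * (a l * suf (suc l)))       ≡⟨ cong (λ x → b l * (pre l * x)) (suf-step l<k) ⟨
    b l * (pre l * suf l)                     ∎
    where
    open ≡-Reasoning
    exchange : ∀ p x y t → x * (p * y * t) ≡ y * (p * (x * t))
    exchange = solve 4 (λ p x y t → x :* (p :* y :* t) := y :* (p :* (x :* t))) refl

  module Rotation
    (a-pos : ∀ n → 0 < a n) (b-pos : ∀ n → 0 < b n)
    (suitable : ∀ i l → l ≤ i → i < k → Coprime (a i) (b l))
    (g : ℕ → ℕ) (g-factors : ∀ l → l ≤ k → g l ≡ pre l * suf l)
    (j : ℕ) (j≤k : j ≤ k) where

    h : ℕ → ℕ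
    h = rho j g

    g-exchange : ∀ {l} → l < k → a l * g (suc l) ≡ b l * g l
    g-exchange {l} l<k = trans (cong (a l *_) (g-factors (suc l) l<k))
                               (trans (factor-exchange l<k) (cong (b l *_) (sym (g-factors l (<⇒≤ l<k)))))

    h-below : ∀ i l → i + l ≡ j → h i ≡ g l
    h-below i l i+l≡j = trans (rho-below g (subst (i ≤_) i+l≡j (m≤m+n i l)))
                              (cong g (trans (cong (_∸ i) (sym i+l≡j)) (m+n∸m≡n i l)))

    dseq-below : ∀ i l → i + l ≡ j → dseq h i ≡ pre l * suf j
    dseq-below zero l l≡j = begin
      h 0             ≡⟨ h-below 0 l l≡j ⟩
      g l             ≡⟨ g-factors l (subst (_≤ k) (sym l≡j) j≤k) ⟩
      pre l * suf l   ≡⟨ cong (λ m → pre l * suf m) l≡j ⟩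
      pre l * suf j   ∎
      where open ≡-Reasoning
    dseq-below (suc i) l i+l≡j = begin
      gcd (dseq h i) (h (suc i))                               ≡⟨ cong₂ gcd (dseq-below i (suc l) (trans (+-suc i l) i+l≡j)) (h-below (suc i) l i+l≡j) ⟩
      gcd (pre (suc l) * suf j) (g l)                          ≡⟨ cong₂ gcd (cong (_* suf j) (pre-step l)) (g-factors l l≤k) ⟩
      gcd (pre l * b l * suf j) (pre l * suf l)                ≡⟨ cong (λ t → gcd (pre l * b l * suf j) (pre l * t)) suf-l ⟩
      gcd (pre l * b l * suf j) (pre l * (between * suf j))    ≡⟨ cong₂ gcd (rearrange₁ (pre l) (b l) (suf j)) (rearrange₂ (pre l) between (suf j)) ⟩
      gcd (pre l * suf j * b l) (pre l * suf j * between)      ≡⟨ gcd-common-factor (pre l * suf j) (b l) between b⊥between ⟩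
      pre l * suf j                                            ∎
      where
      open ≡-Reasoning
      j≡i+l = sym i+l≡j
      l≤k : l ≤ k
      l≤k = ≤-trans (m≤n+m l (suc i)) (subst (_≤ k) j≡i+l j≤k)
      between = prodFrom l (suc i) a
      suf-l : suf l ≡ between * suf j
      suf-l = trans (suf-split (suc i) l (subst (_≤ k) j≡i+l j≤k)) (cong (λ m → between * suf m) i+l≡j)
      b⊥between : Coprime (b l) between
      b⊥between = prodFrom-coprime (b l) l (suc i) a λ m l≤m m<end →
        Coprimality.sym (suitable m l l≤m (<-≤-trans (subst (m <_) (+-comm l (suc i)) m<end) (subst (_≤ k) j≡i+l j≤k)))
      rearrange₁ : ∀ p y t → p * y * t ≡ p * t * y
      rearrange₁ = solve 3 (λ p y t → p :* y :* t := p :* t :* y) refl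
      rearrange₂ : ∀ p y t → p * (y * t) ≡ p * t * y
      rearrange₂ = solve 3 (λ p y t → p :* (y :* t) := p :* t :* y) refl

    dseq-above-offset : ∀ d → d + j ≤ k → dseq h (d + j) ≡ suf (d + j)
    dseq-above-offset zero _ = trans (dseq-below j 0 (+-identityʳ j)) (*-identityˡ (suf j))
    dseq-above-offset (suc d) i<k = begin
      gcd (dseq h i) (h (suc i))                                   ≡⟨ cong₂ gcd (dseq-above-offset d (<⇒≤ i<k)) (rho-above g (s≤s (m≤n+m j d))) ⟩
      gcd (suf i) (g (suc i))                                      ≡⟨ cong₂ gcd (trans (suf-step i<k) (*-comm (a i) _))
                                                                                (trans (g-factors (suc i) i<k) (*-comm (pre (suc i)) _)) ⟩
      gcd (suf (suc i) * a i) (suf (suc i) * pre (suc i))          ≡⟨ gcd-common-factor (suf (suc i)) (a i) (pre (suc i)) a⊥pre ⟩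
      suf (suc i)                                                  ∎
      where
      open ≡-Reasoning
      i = d + j
      a⊥pre : Coprime (a i) (pre (suc i))
      a⊥pre = prodFrom-coprime (a i) 0 (suc i) b λ m _ m≤i → suitable i m (s≤s⁻¹ m≤i) i<k

    dseq-above : ∀ i → j ≤ i → i ≤ k → dseq h i ≡ suf i
    dseq-above i j≤i i≤k = subst (λ m → dseq h m ≡ suf m) (m∸n+n≡m j≤i)
      (dseq-above-offset (i ∸ j) (subst (_≤ k) (sym (m∸n+n≡m j≤i)) i≤k))

    cval-below : ∀ i l → suc i + l ≡ j → cval h (suc i) ≡ b l
    cval-below i l i+l≡j = begin
      quot (dseq h i) (dseq h (suc i))         ≡⟨ cong₂ quot (dseq-below i (suc l) (trans (+-suc i l) i+l≡j)) (dseq-below (suc i) l i+l≡j) ⟩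
      quot (pre (suc l) * suf j) (pre l * suf j) ≡⟨ cong (λ x → quot x (pre l * suf j)) (trans (cong (_* suf j) (pre-step l)) (rearrange (pre l) (b l) (suf j))) ⟩
      quot (pre l * suf j * b l) (pre l * suf j) ≡⟨ quot-cancel (pre l * suf j) (b l) (*-pos (prodFrom-pos 0 l b b-pos) (prodFrom-pos j (k ∸ j) a a-pos)) ⟩
      b l                                      ∎
      where
      open ≡-Reasoning
      rearrange : ∀ p y t → p * y * t ≡ p * t * y
      rearrange = solve 3 (λ p y t → p :* y :* t := p :* t :* y) refl

    cval-above : ∀ l → j ≤ l → l < k → cval h (suc l) ≡ a l
    cval-above l j≤l l<k = begin
      quot (dseq h l) (dseq h (suc l))      ≡⟨ cong₂ quot (dseq-above l j≤l (<⇒≤ l<k)) (dseq-above (suc l) (m≤n⇒m≤1+n j≤l) l<k) ⟩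
      quot (suf l) (suf (suc l))            ≡⟨ cong (λ x → quot x (suf (suc l))) (trans (suf-step l<k) (*-comm (a l) _)) ⟩
      quot (suf (suc l) * a l) (suf (suc l)) ≡⟨ quot-cancel (suf (suc l)) (a l) (prodFrom-pos (suc l) (k ∸ suc l) a a-pos) ⟩
      a l                                   ∎
      where open ≡-Reasoning

    -- c values in the indexing of the statement
    cval-reversed : ∀ l → l < j → cval h (j ∸ l) ≡ b l
    cval-reversed l l<j = subst (λ i → cval h i ≡ b l) (sym (∸-unfold l<j))
      (cval-below (j ∸ suc l) l (trans (sym (+-suc (j ∸ suc l) l)) (m∸n+n≡m l<j)))

    -- inside the reversed block: c_{i+1} h_{i+1} = b_l g_l = a_l g_{l+1} = a_l h_i
    smooth-below : ∀ i l → suc i + l ≡ j → InSemigroup h (suc i) (cval h (suc i) * h (suc i))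
    smooth-below i l i+l≡j = subst (InSemigroup h (suc i)) (sym multiple) (single-generator h (a l) ≤-refl)
      where
      open ≡-Reasoning
      l<k : l < k
      l<k = <-≤-trans (subst (l <_) i+l≡j (m<n+m l (s≤s z≤n))) j≤k
      multiple : cval h (suc i) * h (suc i) ≡ a l * h i
      multiple = begin
        cval h (suc i) * h (suc i)   ≡⟨ cong₂ _*_ (cval-below i l i+l≡j) (h-below (suc i) l i+l≡j) ⟩
        b l * g l                    ≡⟨ g-exchange l<k ⟨
        a l * g (suc l)              ≡⟨ cong (a l *_) (h-below i (suc l) (trans (+-suc i l) i+l≡j)) ⟨
        a l * h i                    ∎

    earlier-occurrence : ∀ l → j ≤ l → Σ ℕ λ r → r < suc l × h r ≡ g l
    earlier-occurrence l j≤l with m≤n⇒m<n∨m≡n j≤l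
    ... | inj₁ j<l = l , ≤-refl , rho-above g j<l
    ... | inj₂ refl = 0 , s≤s z≤n , refl

    -- past the block: c_{l+1} h_{l+1} = a_l g_{l+1} = b_l g_l = b_l h_r
    smooth-above : ∀ l → j ≤ l → l < k → InSemigroup h (suc l) (cval h (suc l) * h (suc l))
    smooth-above l j≤l l<k with earlier-occurrence l j≤l
    ... | r , r<l+1 , hr≡gl = subst (InSemigroup h (suc l)) (sym multiple) (single-generator h (b l) r<l+1)
      where
      open ≡-Reasoning
      multiple : cval h (suc l) * h (suc l) ≡ b l * h r
      multiple = begin
        cval h (suc l) * h (suc l)   ≡⟨ cong₂ _*_ (cval-above l j≤l l<k) (rho-above g (s≤s j≤l)) ⟩
        a l * g (suc l)              ≡⟨ g-exchange l<k ⟩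
        b l * g l                    ≡⟨ cong (b l *_) hr≡gl ⟨
        b l * h r                    ∎

    smooth : Smooth k h
    smooth zero () _
    smooth (suc i) _ i<k with suc i ≤? j
    ... | yes i<j = smooth-below i (j ∸ suc i) (m+[n∸m]≡n i<j)
    ... | no i≮j = smooth-above i (s≤s⁻¹ (≰⇒> i≮j)) i<k

compound-factorisation : ∀ {k} (a b : Fin k → ℕ) l → l ≤ k →
  compound a b l ≡ CompoundSequence.pre k (extend a) (extend b) l * CompoundSequence.suf k (extend a) (extend b) l
compound-factorisation {k} a b l l≤k =
  trans (cong product (map-tabulate (λ m → m) F))
        (trans (product-allFin F (select l) 0 agree) (select-factorisation l l≤k))
  where
  open CompoundSequence k (extend a) (extend b)
  F : Fin k → ℕ
  F m = if toℕ m <ᵇ l then b m else a m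
  agree : ∀ m → F m ≡ select l (toℕ m + 0)
  agree m rewrite +-identityʳ (toℕ m) with toℕ m <ᵇ l
  ... | true = sym (extend-toℕ b m)
  ... | false = sym (extend-toℕ a m)

proposition3p10 : (k : ℕ) (a b : Fin k → ℕ) → Positive a → Positive b → Suitable a b →
    (j : Fin (suc k)) →
    Smooth k (rho (toℕ j) (compound a b))
    × ((m : Fin k) → toℕ m < toℕ j → cval (rho (toℕ j) (compound a b)) (toℕ j ∸ toℕ m) ≡ b m)
    × ((m : Fin k) → toℕ j < suc (toℕ m) → cval (rho (toℕ j) (compound a b)) (suc (toℕ m)) ≡ a m)
proposition3p10 k a b a-pos b-pos suitable j =
    smooth
  , (λ m m<j → trans (cval-reversed (toℕ m) m<j) (extend-toℕ b m))
  , (λ m j≤m → trans (cval-above (toℕ m) (s≤s⁻¹ j≤m) (toℕ<n m)) (extend-toℕ a m))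
  where
  open CompoundSequence.Rotation k (extend a) (extend b)
    (extend-pos a a-pos) (extend-pos b b-pos) (extend-suitable a b suitable)
    (compound a b) (compound-factorisation a b) (toℕ j) (s≤s⁻¹ (toℕ<n j))
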